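{- Let $K$ be a real quadratic field with notation as below. Let $d$ be a positive integer, and let $r$ be the order of $\varepsilon+d\mathcal{O}_K$ in $(\mathcal{O}_K/d\mathcal{O}_K)^\times$. Write $d=2^{\ell_1}(2a+1)$ and $r=2^{\ell_2}(2b+1)$ with $\ell_1,\ell_2,a,b$ non-negative integers, let $\ell=\max\{\ell_1,\ell_2\}$, and let $j,m$ be positive integers with $2^\ell\mid j$ and $(2a+1)(2b+1)\mid(2m+1)$. If $d$ is even, assume in addition that $j$ is coprime to $3$ and that $3\mid(2m+1)$. Then: (1) if $d_1$ is even, then $d\mid d_{j,m}$; (2) if $d_1$ is odd, then $d\mid d_{j,m}$ if and only if $d$ is odd.
   Context: Let $K\subset\mathbb{R}$ be a real quadratic field of discriminant $\Delta_0$ with ring of integers $\mathcal{O}_K$, and let $\varepsilon$ be the smallest unit of $K$ of norm $+1$ that is greater than $1$. For positive integers $j$ set $f_j=(\varepsilon^j-\varepsilon^{ -j})/\sqrt{\Delta_0}$. For positive integers $j,m$ set $r_{j,m}=f_{jm}/f_j$, $d_{j,m}=r_{j,m+1}+r_{j,m}$, and $d_1=d_{1,1}$ (which equals $\varepsilon+\varepsilon^{ -1}+1$). -}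

module Defs where

open import Data.Nat as ℕ using (ℕ; zero; suc)
open import Data.Nat.DivMod as ℕD using ()
open import Data.Nat.Divisibility as ℕDiv using ()
open import Data.Integer as ℤ using (ℤ; +_; -[1+_])
open import Data.Integer.DivMod as ℤD using ()
open import Data.Integer.Divisibility as ℤDiv using ()
open import Data.Product using (_×_; _,_; Σ; proj₁; proj₂)
open import Data.Sum using (_⊎_)
open import Relation.Binary.PropositionalEquality using (_≡_)
open import Relation.Nullary using (¬_)

SquareFree : ℕ → Set
SquareFree n = ∀ (p : ℕ) → (p ℕ.* p) ℕDiv.∣ n → p ≡ 1

IsRealQuadDisc : ℕ → Set
IsRealQuadDisc D =
  1 ℕ.< D ×
  ((D ℕD.% 4 ≡ 1 × SquareFree D)
   ⊎ Σ ℕ (λ n → D ≡ 4 ℕ.* n × (n ℕD.% 4 ≡ 2 ⊎ n ℕD.% 4 ≡ 3) × SquareFree n))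

-- Elements of O_K = ℤ[ω], ω = (Δ₀ + √Δ₀)/2, written as (x , y) ↦ x + y ω.
-- ω² = Δ₀ ω - c  with  c = (Δ₀² - Δ₀)/4.

OK : Set
OK = ℤ × ℤ

cst : ℕ → ℤ
cst D = + ((D ℕ.* D ℕ.∸ D) ℕD./ 4)

oneK : OK
oneK = (+ 1 , + 0)

mulK : ℕ → OK → OK → OK
mulK D (x₁ , y₁) (x₂ , y₂) =
  ( x₁ ℤ.* x₂ ℤ.- cst D ℤ.* (y₁ ℤ.* y₂)
  , x₁ ℤ.* y₂ ℤ.+ x₂ ℤ.* y₁ ℤ.+ (+ D) ℤ.* (y₁ ℤ.* y₂) )

powK : ℕ → OK → ℕ → OK
powK D α zero    = oneK
powK D α (suc n) = mulK D α (powK D α n)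

normK : ℕ → OK → ℤ
normK D (x , y) = x ℤ.* x ℤ.+ (+ D) ℤ.* (x ℤ.* y) ℤ.+ cst D ℤ.* (y ℤ.* y)

IsUnitK : ℕ → OK → Set
IsUnitK D α = Σ OK (λ β → mulK D α β ≡ oneK)

-- The real embedding and the order of ℝ.
-- PosSqrt D A B  :⇔  A + B √D > 0  (as a real number), for D not a square.
PosSqrt : ℕ → ℤ → ℤ → Set
PosSqrt D A B =
  (+ 0 ℤ.< A × + 0 ℤ.≤ B)
  ⊎ (+ 0 ℤ.≤ A × + 0 ℤ.< B)
  ⊎ (+ 0 ℤ.< A × B ℤ.< + 0 × B ℤ.* B ℤ.* (+ D) ℤ.< A ℤ.* A)
  ⊎ (A ℤ.< + 0 × + 0 ℤ.< B × A ℤ.* A ℤ.< B ℤ.* B ℤ.* (+ D))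

-- α > β as real numbers, where x + yω = ((2x + yΔ₀) + y√Δ₀)/2.
GtK : ℕ → OK → OK → Set
GtK D (x₁ , y₁) (x₂ , y₂) =
  PosSqrt D ((+ 2) ℤ.* (x₁ ℤ.- x₂) ℤ.+ (y₁ ℤ.- y₂) ℤ.* (+ D)) (y₁ ℤ.- y₂)

IsEps : ℕ → OK → Set
IsEps D ε =
  IsUnitK D ε × normK D ε ≡ + 1 × GtK D ε oneK ×
  (∀ (η : OK) → IsUnitK D η → normK D η ≡ + 1 → GtK D η oneK →
     η ≡ ε ⊎ GtK D η ε)

CongK : ℕ → OK → OK → Set
CongK d (x₁ , y₁) (x₂ , y₂) =
  (+ d) ℤDiv.∣ (x₁ ℤ.- x₂) × (+ d) ℤDiv.∣ (y₁ ℤ.- y₂)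

IsOrderMod : ℕ → ℕ → OK → ℕ → Set
IsOrderMod D d ε r =
  0 ℕ.< r × CongK d (powK D ε r) oneK ×
  (∀ (s : ℕ) → 0 ℕ.< s → s ℕ.< r → ¬ CongK d (powK D ε s) oneK)

-- f_j = (ε^j - ε^{-j})/√Δ₀.  Since N(ε) = 1, ε^{-j} is the conjugate of ε^j,
-- and (x + yω) - conj(x + yω) = y √Δ₀; hence f_j = ω-coordinate of ε^j.
fK : ℕ → OK → ℕ → ℤ
fK D ε j = proj₂ (powK D ε j)

-- integer quotient (only ever applied to exact quotients f_{jm}/f_j, f_j ≠ 0)
quotℤ : ℤ → ℤ → ℤ
quotℤ a (+ zero)    = + 0
quotℤ a (+ suc n)   = a ℤD./ (+ suc n)
quotℤ a (-[1+ n ])  = a ℤD./ (-[1+ n ])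

rK : ℕ → OK → ℕ → ℕ → ℤ
rK D ε j m = quotℤ (fK D ε (j ℕ.* m)) (fK D ε j)

dK : ℕ → OK → ℕ → ℕ → ℤ
dK D ε j m = rK D ε j (suc m) ℤ.+ rK D ε j m

d₁K : ℕ → OK → ℤ
d₁K D ε = dK D ε 1 1

-- Write η = ε^j, s = tr η, and let U be the Lucas sequence U₀ = 0, U₁ = 1,
-- U_{k+2} = s U_{k+1} − U_k.  Since N(η) = 1, η² = sη − 1, hence
-- η^k = U_k η − U_{k−1}; comparing ω-coordinates gives f_{jk} = U_k f_j, so
-- r_{j,m} = U_m and d_{j,m} = U_{m+1} + U_m.  The same recursion yields
--   η^m d_{j,m} = 1 + η + ⋯ + η^{2m},
-- and as η is a unit, d ∣ d_{j,m} amounts to this geometric sum vanishing in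
-- O_K/dO_K.  Write d = 2^ℓ₁ o with o odd.  Since r ∣ j(2b+1), η^{2b+1} = 1
-- modulo d, and 2m+1 is a multiple of o(2b+1); so modulo o the sum is a
-- multiple of o times a full period sum, i.e. 0.  If d is even and
-- d₁ = tr ε + 1 is even, then ε² + ε + 1 = d₁ε ≡ 0 (mod 2), hence
-- η² + η + 1 ≡ 0 (mod 2) as 3 ∤ j.  Modulo 2^ℓ₁ the element 2 is nilpotent,
-- so everything ≡ 1 (mod 2) is a unit; as η has odd order this lifts
-- η² + η + 1 ≡ 0 to modulo 2^ℓ₁, and then 3 ∣ 2m+1 makes the sum vanish.
-- Finally, if d₁ is odd then every s is even and d_{j,m} ≡ d_{j,m−2} (mod 2)
-- is odd, so no even d divides it.
module Submission where

open import Defs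
open import Data.Nat as ℕ using (ℕ; zero; suc; s≤s; _⊔_)
import Data.Nat.Properties as ℕP
import Data.Nat.DivMod as ℕD
open import Data.Nat.Divisibility as ℕDiv using (divides)
open import Data.Nat.Coprimality using (Coprime; coprime-divisor; coprime⇒gcd≡1)
open import Data.Nat.LCM using (lcm; lcm-least; gcd*lcm)
import Data.Nat.Tactic.RingSolver as ℕSolver
import Data.Integer
open import Data.Integer as ℤ using (ℤ; +_; -[1+_])
import Data.Integer.Properties as ℤP
import Data.Integer.DivMod as ℤD
open import Data.Integer.Divisibility as ℤDiv using ()
open import Data.Integer.Divisibility.Signed as ℤS using (divides)
open import Data.Integer.Tactic.RingSolver using (solve-∀)
open import Data.Product using (_×_; _,_; proj₁; proj₂; Σ; ∃₂)
open import Data.Sum using (inj₁; inj₂)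
open import Data.Maybe using (Maybe; just; nothing)
open import Data.Empty using (⊥-elim)
open import Function using (_∘_; case_of_)
open import Function.Bundles using (_⇔_; mk⇔)
open import Relation.Nullary using (¬_; yes; no)
open import Relation.Binary.PropositionalEquality as ≡
  using (_≡_; _≢_; cong; cong₂; subst; module ≡-Reasoning)
open import Algebra.Bundles using (CommutativeRing)
open import Algebra.Solver.Ring.AlmostCommutativeRing
  using (fromCommutativeRing; _-Raw-AlmostCommutative⟶_)
open import Level using (0ℓ)

-- Lucas sequences

module _ where
  open Data.Integer using (_+_; _*_; _-_)

  lucasU : ℤ → ℕ → ℤ
  lucasU s zero = + 0
  lucasU s (suc zero) = + 1
  lucasU s (suc (suc k)) = s * lucasU s (suc k) - lucasU s k

  -- r_{j,m} = lucasU (tr ε^j) m and d_{j,m} = lucasSum (tr ε^j) m, see rK≡lucasU.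
  lucasSum : ℤ → ℕ → ℤ
  lucasSum s m = lucasU s (suc m) + lucasU s m

  lucasSum-one : ∀ s → lucasSum s 1 ≡ s + + 1
  lucasSum-one s = identity s
    where
    identity : ∀ s → s * + 1 - + 0 + + 1 ≡ s + + 1
    identity = solve-∀

  lucasSum-rec : ∀ s m → lucasSum s (2 ℕ.+ m) ≡ s * lucasSum s (suc m) - lucasSum s m
  lucasSum-rec s m = identity s (lucasU s (suc m)) (lucasU s m)
    where
    identity : ∀ s u v → (s * (s * u - v) - u) + (s * u - v) ≡ s * ((s * u - v) + u) - (u + v)
    identity = solve-∀

  lucasU-increasing : ∀ u k → ∃₂ λ a b → lucasU (+ (2 ℕ.+ u)) k ≡ + a × lucasU (+ (2 ℕ.+ u)) (suc k) ≡ + (a ℕ.+ suc b)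
  lucasU-increasing u zero = 0 , 0 , ≡.refl , ≡.refl
  lucasU-increasing u (suc k) with lucasU-increasing u k
  ... | a , b , Uₖ≡a , Uₖ₊₁≡a+1+b = a ℕ.+ suc b , b ℕ.+ u ℕ.* (a ℕ.+ suc b) , Uₖ₊₁≡a+1+b ,
      ≡.trans (cong₂ (λ x y → + (2 ℕ.+ u) * x - y) Uₖ₊₁≡a+1+b Uₖ≡a) step
    where
    open ≡-Reasoning
    c c′ : ℕ
    c = a ℕ.+ suc b
    c′ = c ℕ.+ suc (b ℕ.+ u ℕ.* c)
    step : + (2 ℕ.+ u) * + c - + a ≡ + c′
    step = begin
      + (2 ℕ.+ u) * + c - + a    ≡⟨ cong (_- + a) (ℤP.pos-* (2 ℕ.+ u) c) ⟨
      + ((2 ℕ.+ u) ℕ.* c) - + a  ≡⟨ cong (λ x → + x - + a) (expand a b u) ⟩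
      + (a ℕ.+ c′) - + a         ≡⟨ cong (_- + a) (ℤP.pos-+ a c′) ⟩
      + a + + c′ - + a           ≡⟨ cancel (+ a) (+ c′) ⟩
      + c′                       ∎
      where
      expand : ∀ a b u → (2 ℕ.+ u) ℕ.* (a ℕ.+ suc b) ≡ a ℕ.+ ((a ℕ.+ suc b) ℕ.+ suc (b ℕ.+ u ℕ.* (a ℕ.+ suc b)))
      expand = ℕSolver.solve-∀
      cancel : ∀ x y → x + y - x ≡ y
      cancel = solve-∀

  lucasU-nonzero : ∀ u k → lucasU (+ (2 ℕ.+ u)) (suc k) ≢ + 0
  lucasU-nonzero u k Uₖ₊₁≡0 with lucasU-increasing u k
  ... | a , b , _ , Uₖ₊₁≡a+1+b =
    ℕP.1+n≢0 (≡.trans (≡.sym (ℕP.+-suc a b)) (ℤP.+-injective (≡.trans (≡.sym Uₖ₊₁≡a+1+b) Uₖ₊₁≡0)))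

  ¬2∣1 : ¬ + 2 ℤS.∣ + 1
  ¬2∣1 2∣1 with ℕDiv.∣1⇒≡1 (ℤS.∣⇒∣ᵤ 2∣1)
  ... | ()

  lucasSum-odd : ∀ {s} → + 2 ℤS.∣ s → ∀ m → ¬ + 2 ℤS.∣ lucasSum s m
  lucasSum-odd 2∣s zero = ¬2∣1
  lucasSum-odd {s} 2∣s (suc zero) 2∣E = ¬2∣1 (ℤS.∣m+n∣m⇒∣n (subst (+ 2 ℤS.∣_) (lucasSum-one s) 2∣E) 2∣s)
  lucasSum-odd {s} 2∣s (suc (suc m)) 2∣E = lucasSum-odd 2∣s m (subst (+ 2 ℤS.∣_) (identity (s * E₁) E₀)
    (ℤS.∣m∣n⇒∣m-n (ℤS.∣m⇒∣m*n E₁ 2∣s) (subst (+ 2 ℤS.∣_) (lucasSum-rec s m) 2∣E)))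
    where
    E₁ E₀ : ℤ
    E₁ = lucasSum s (suc m)
    E₀ = lucasSum s m
    identity : ∀ a b → a - (a - b) ≡ b
    identity = solve-∀

module _ where
  open Data.Integer using (_+_; _*_; _-_; _<_; _≤_)

  i*j/j≡i : ∀ i j .{{_ : ℤ.NonZero j}} → (i * j) ℤD./ j ≡ i
  i*j/j≡i i j = ≡.sym (ℤP.i-j≡0⇒i≡j i q (ℤP.∣i∣≡0⇒i≡0 ∣i-q∣≡0))
    where
    q : ℤ
    q = (i * j) ℤD./ j
    r : ℕ
    r = (i * j) ℤD.% j
    r≡[i-q]j : + r ≡ (i - q) * j
    r≡[i-q]j = begin
      + r                 ≡⟨ identity₁ (+ r) q j ⟨
      + r + q * j - q * j ≡⟨ cong (_- q * j) (ℤD.a≡a%n+[a/n]*n (i * j) j) ⟨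
      i * j - q * j       ≡⟨ identity₂ i q j ⟩
      (i - q) * j         ∎
      where
      open ≡-Reasoning
      identity₁ : ∀ r q j → r + q * j - q * j ≡ r
      identity₁ = solve-∀
      identity₂ : ∀ i q j → i * j - q * j ≡ (i - q) * j
      identity₂ = solve-∀
    ∣i-q∣≡0 : ℤ.∣ i - q ∣ ≡ 0
    ∣i-q∣≡0 = ℕP.n<1⇒n≡0 (ℕP.*-cancelʳ-< ℤ.∣ j ∣ _ 1 (begin-strict
      ℤ.∣ i - q ∣ ℕ.* ℤ.∣ j ∣ ≡⟨ ℤP.abs-* (i - q) j ⟨
      ℤ.∣ (i - q) * j ∣       ≡⟨ cong ℤ.∣_∣ r≡[i-q]j ⟨
      r                        <⟨ ℤD.n%d<d (i * j) j ⟩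
      ℤ.∣ j ∣                  ≡⟨ ℕP.+-identityʳ _ ⟨
      1 ℕ.* ℤ.∣ j ∣            ∎))
      where open ℕP.≤-Reasoning

  quotℤ-exact : ∀ i j → j ≢ + 0 → quotℤ (i * j) j ≡ i
  quotℤ-exact i (+ zero) j≢0 = ⊥-elim (j≢0 ≡.refl)
  quotℤ-exact i (+ suc n) _ = i*j/j≡i i (+ suc n)
  quotℤ-exact i -[1+ n ] _ = i*j/j≡i i -[1+ n ]

  ¬2∣z+1⇒2∣z : ∀ z → ¬ + 2 ℤS.∣ z + + 1 → + 2 ℤS.∣ z
  ¬2∣z+1⇒2∣z z ¬2∣z+1 with z ℤD.% + 2 | ℤD.a≡a%n+[a/n]*n z (+ 2) | ℤD.n%d<d z (+ 2)
  ... | 0 | z≡ | _ = divides (z ℤD./ + 2) (≡.trans z≡ (ℤP.+-identityˡ _))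
  ... | 1 | z≡ | _ = ⊥-elim (¬2∣z+1 (divides (z ℤD./ + 2 + + 1) (≡.trans (cong (_+ + 1) z≡) (identity (z ℤD./ + 2)))))
    where
    identity : ∀ q → + 1 + q * + 2 + + 1 ≡ (q + + 1) * + 2
    identity = solve-∀
  ... | suc (suc _) | _ | s≤s (s≤s ())

  m*[m∸1]≡m*m∸m : ∀ m → m ℕ.* (m ℕ.∸ 1) ≡ m ℕ.* m ℕ.∸ m
  m*[m∸1]≡m*m∸m m = ≡.trans (ℕP.*-distribˡ-∸ m m 1) (cong (m ℕ.* m ℕ.∸_) (ℕP.*-identityʳ m))

  4∣D²-D : ∀ D → IsRealQuadDisc D → 4 ℕDiv.∣ D ℕ.* D ℕ.∸ D
  4∣D²-D D (_ , inj₁ (D%4≡1 , _)) = subst (4 ℕDiv.∣_) (m*[m∸1]≡m*m∸m D) (ℕDiv.∣n⇒∣m*n D (divides (D ℕ./ 4)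
    (cong (ℕ._∸ 1) (≡.trans (ℕD.m≡m%n+[m/n]*n D 4) (cong (ℕ._+ D ℕ./ 4 ℕ.* 4) D%4≡1)))))
  4∣D²-D D (_ , inj₂ (n , D≡4n , _)) = subst (4 ℕDiv.∣_) (m*[m∸1]≡m*m∸m D)
    (ℕDiv.∣m⇒∣m*n (D ℕ.∸ 1) (divides n (≡.trans D≡4n (ℕP.*-comm 4 n))))

  4cst≡D²-D : ∀ D → IsRealQuadDisc D → + 4 * cst D ≡ + D * + D - + D
  4cst≡D²-D D@(suc _) qd = begin
    + 4 * + (N ℕ./ 4)   ≡⟨ ℤP.pos-* 4 (N ℕ./ 4) ⟨
    + (4 ℕ.* (N ℕ./ 4)) ≡⟨ cong +_ (ℕD.m*[n/m]≡n (4∣D²-D D qd)) ⟩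
    + N                 ≡⟨ identity (+ N) (+ D) ⟨
    + N + + D - + D     ≡⟨ cong (_- + D) (ℤP.pos-+ N D) ⟨
    + (N ℕ.+ D) - + D   ≡⟨ cong (λ x → + x - + D) (ℕP.m∸n+n≡m (ℕP.m≤m*n D D)) ⟩
    + (D ℕ.* D) - + D   ≡⟨ cong (_- + D) (ℤP.pos-* D D) ⟩
    + D * + D - + D     ∎
    where
    open ≡-Reasoning
    N : ℕ
    N = D ℕ.* D ℕ.∸ D
    identity : ∀ n d → n + d - d ≡ n
    identity = solve-∀

  posSqrt-unit : ∀ {D A B} → B * B * + D ≡ A * A + + 4 * A → PosSqrt D A B → + 0 ≤ A × B ≢ + 0
  posSqrt-unit {A = A} norm (inj₁ (0<A , _)) = ℤP.<⇒≤ 0<A , λ { ≡.refl → no-root A 0<A (≡.sym norm) }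
    where
    no-root : ∀ A → + 0 < A → A * A + + 4 * A ≢ + 0
    no-root (+ zero) (ℤ.+<+ ())
    no-root (+ suc k) _ ()
  posSqrt-unit _ (inj₂ (inj₁ (0≤A , 0<B))) = 0≤A , λ { ≡.refl → ℤP.<-irrefl ≡.refl 0<B }
  posSqrt-unit _ (inj₂ (inj₂ (inj₁ (0<A , B<0 , _)))) = ℤP.<⇒≤ 0<A , λ { ≡.refl → ℤP.<-irrefl ≡.refl B<0 }
  posSqrt-unit {A = A} norm (inj₂ (inj₂ (inj₂ (A<0 , _ , A²<B²D)))) =
    ⊥-elim (ℤP.<-asym (subst (A * A <_) norm A²<B²D) A²+4A<A²)
    where
    4A<0 : ∀ A → A < + 0 → + 4 * A < + 0
    4A<0 (+ n) (ℤ.+<+ ())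
    4A<0 -[1+ k ] _ = ℤ.-<+
    A²+4A<A² : A * A + + 4 * A < A * A
    A²+4A<A² = subst (A * A + + 4 * A <_) (ℤP.+-identityʳ (A * A)) (ℤP.+-monoʳ-< (A * A) (4A<0 A A<0))

2^ℓ-coprime-odd : ∀ ℓ a → Coprime (2 ℕ.^ ℓ) (2 ℕ.* a ℕ.+ 1)
2^ℓ-coprime-odd zero a (k∣1 , _) = ℕDiv.∣1⇒≡1 k∣1
2^ℓ-coprime-odd (suc ℓ) a {k} (k∣2·2^ℓ , k∣o) = 2^ℓ-coprime-odd ℓ a (coprime-divisor k-coprime-2 k∣2·2^ℓ , k∣o)
  where
  k-coprime-2 : Coprime k 2
  k-coprime-2 (i∣k , i∣2) = ℕDiv.∣1⇒≡1 (ℕDiv.∣m+n∣m⇒∣n (ℕDiv.∣-trans i∣k k∣o) (ℕDiv.∣m⇒∣m*n a i∣2))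

coprime⇒*-∣ : ∀ {m n k} → Coprime m n → m ℕDiv.∣ k → n ℕDiv.∣ k → m ℕ.* n ℕDiv.∣ k
coprime⇒*-∣ {m} {n} m⊥n m∣k n∣k = subst (ℕDiv._∣ _) lcm≡m*n (lcm-least m∣k n∣k)
  where
  lcm≡m*n : lcm m n ≡ m ℕ.* n
  lcm≡m*n = ≡.trans (≡.sym (ℕP.*-identityˡ (lcm m n)))
    (≡.trans (cong (ℕ._* lcm m n) (≡.sym (coprime⇒gcd≡1 m⊥n))) (gcd*lcm m n))

^-monoʳ-∣ : ∀ b {m n} → m ℕ.≤ n → b ℕ.^ m ℕDiv.∣ b ℕ.^ n
^-monoʳ-∣ b {m} {n} m≤n = divides (b ℕ.^ (n ℕ.∸ m))
  (≡.trans (cong (b ℕ.^_) (≡.sym (ℕP.m+[n∸m]≡n m≤n))) (≡.trans (ℕP.^-distribˡ-+-* b m (n ℕ.∸ m)) (ℕP.*-comm (b ℕ.^ m) _)))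

module _ where
  open Data.Integer using (_+_; _*_; _-_; -_)
  open ℤS using (_∣_; ∣m∣n⇒∣m+n; ∣m⇒∣-m; ∣m⇒∣m*n; ∣n⇒∣m*n)

  infix 4 _≡ℤ_mod_
  record _≡ℤ_mod_ (x y : ℤ) (n : ℕ) : Set where
    constructor mod-witness
    field
      ∣-difference : + n ∣ x - y

  module _ {n : ℕ} where
    private
      via : ∀ {x y z} → z ≡ x - y → + n ∣ z → x ≡ℤ y mod n
      via z≡x-y n∣z = mod-witness (subst (+ n ∣_) z≡x-y n∣z)

    ≡ℤ-refl : ∀ {x} → x ≡ℤ x mod n
    ≡ℤ-refl {x} = mod-witness (divides (+ 0) (≡.trans (ℤP.+-inverseʳ x) (≡.sym (ℤP.*-zeroˡ (+ n)))))

    ≡ℤ-sym : ∀ {x y} → x ≡ℤ y mod n → y ≡ℤ x mod n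
    ≡ℤ-sym {x} {y} (mod-witness p) = via (identity x y) (∣m⇒∣-m p)
      where
      identity : ∀ x y → - (x - y) ≡ y - x
      identity = solve-∀

    ≡ℤ-trans : ∀ {x y z} → x ≡ℤ y mod n → y ≡ℤ z mod n → x ≡ℤ z mod n
    ≡ℤ-trans {x} {y} {z} (mod-witness p) (mod-witness q) = via (identity x y z) (∣m∣n⇒∣m+n p q)
      where
      identity : ∀ x y z → (x - y) + (y - z) ≡ x - z
      identity = solve-∀

    +-cong-mod : ∀ {x x′ y y′} → x ≡ℤ x′ mod n → y ≡ℤ y′ mod n → x + y ≡ℤ x′ + y′ mod n
    +-cong-mod {x} {x′} {y} {y′} (mod-witness p) (mod-witness q) = via (identity x x′ y y′) (∣m∣n⇒∣m+n p q)
      where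
      identity : ∀ x x′ y y′ → (x - x′) + (y - y′) ≡ (x + y) - (x′ + y′)
      identity = solve-∀

    neg-cong-mod : ∀ {x x′} → x ≡ℤ x′ mod n → - x ≡ℤ - x′ mod n
    neg-cong-mod {x} {x′} (mod-witness p) = via (identity x x′) (∣m⇒∣-m p)
      where
      identity : ∀ x x′ → - (x - x′) ≡ (- x) - (- x′)
      identity = solve-∀

    *-cong-mod : ∀ {x x′ y y′} → x ≡ℤ x′ mod n → y ≡ℤ y′ mod n → x * y ≡ℤ x′ * y′ mod n
    *-cong-mod {x} {x′} {y} {y′} (mod-witness p) (mod-witness q) =
      via (identity x x′ y y′) (∣m∣n⇒∣m+n (∣m⇒∣m*n y p) (∣n⇒∣m*n x′ q))
      where
      identity : ∀ x x′ y y′ → (x - x′) * y + x′ * (y - y′) ≡ (x * y) - (x′ * y′)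
      identity = solve-∀

  ≡ℤ-mod-0⇒≡ : ∀ {x y} → x ≡ℤ y mod 0 → x ≡ y
  ≡ℤ-mod-0⇒≡ {x} {y} (mod-witness (divides q x-y≡q*0)) = ℤP.i-j≡0⇒i≡j x y (≡.trans x-y≡q*0 (ℤP.*-zeroʳ q))

-- The ring ℤ[ω] = O_K and its residue rings

-- A data type rather than the pair type OK, so that ring expressions in
-- variables stay stuck instead of unfolding to pairs of projections, which
-- would defeat the unifier.
infix 5 ⟨_,_⟩
data ℤ[ω] : Set where
  ⟨_,_⟩ : ℤ → ℤ → ℤ[ω]

fromOK : OK → ℤ[ω]
fromOK (x , y) = ⟨ x , y ⟩

im : ℤ[ω] → ℤ
im ⟨ x , y ⟩ = y

module _ where
  open Data.Integer using (_+_; _*_; _-_; -_)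

  addω : ℤ[ω] → ℤ[ω] → ℤ[ω]
  addω ⟨ x₁ , y₁ ⟩ ⟨ x₂ , y₂ ⟩ = ⟨ x₁ + x₂ , y₁ + y₂ ⟩

  negω : ℤ[ω] → ℤ[ω]
  negω ⟨ x , y ⟩ = ⟨ - x , - y ⟩

  mulω : ℕ → ℤ[ω] → ℤ[ω] → ℤ[ω]
  mulω D ⟨ x₁ , y₁ ⟩ ⟨ x₂ , y₂ ⟩ = fromOK (mulK D (x₁ , y₁) (x₂ , y₂))

  0ω 1ω : ℤ[ω]
  0ω = ⟨ + 0 , + 0 ⟩
  1ω = ⟨ + 1 , + 0 ⟩

  embed : ℤ → ℤ[ω]
  embed a = ⟨ a , + 0 ⟩

  powω : ℕ → ℤ[ω] → ℕ → ℤ[ω]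
  powω D α zero = 1ω
  powω D α (suc k) = mulω D α (powω D α k)

  fromOK-powK : ∀ D α k → fromOK (powK D α k) ≡ powω D (fromOK α) k
  fromOK-powK D α zero = ≡.refl
  fromOK-powK D α (suc k) = cong (mulω D (fromOK α)) (fromOK-powK D α k)

  normω : ℕ → ℤ[ω] → ℤ
  normω D ⟨ x , y ⟩ = normK D (x , y)

  traceω : ℕ → ℤ[ω] → ℤ
  traceω D ⟨ x , y ⟩ = + 2 * x + + D * y

  addω-assoc : ∀ α β γ → addω (addω α β) γ ≡ addω α (addω β γ)
  addω-assoc ⟨ x₁ , y₁ ⟩ ⟨ x₂ , y₂ ⟩ ⟨ x₃ , y₃ ⟩ = cong₂ ⟨_,_⟩ (ℤP.+-assoc x₁ x₂ x₃) (ℤP.+-assoc y₁ y₂ y₃)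

  addω-comm : ∀ α β → addω α β ≡ addω β α
  addω-comm ⟨ x₁ , y₁ ⟩ ⟨ x₂ , y₂ ⟩ = cong₂ ⟨_,_⟩ (ℤP.+-comm x₁ x₂) (ℤP.+-comm y₁ y₂)

  addω-identityˡ : ∀ α → addω 0ω α ≡ α
  addω-identityˡ ⟨ x , y ⟩ = cong₂ ⟨_,_⟩ (ℤP.+-identityˡ x) (ℤP.+-identityˡ y)

  addω-inverseˡ : ∀ α → addω (negω α) α ≡ 0ω
  addω-inverseˡ ⟨ x , y ⟩ = cong₂ ⟨_,_⟩ (ℤP.+-inverseˡ x) (ℤP.+-inverseˡ y)

  module _ (D : ℕ) where
    private
      c e : ℤ
      c = cst D
      e = + D

    mulω-assoc : ∀ α β γ → mulω D (mulω D α β) γ ≡ mulω D α (mulω D β γ)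
    mulω-assoc ⟨ x₁ , y₁ ⟩ ⟨ x₂ , y₂ ⟩ ⟨ x₃ , y₃ ⟩ = cong₂ ⟨_,_⟩ (identity₁ c e x₁ y₁ x₂ y₂ x₃ y₃) (identity₂ c e x₁ y₁ x₂ y₂ x₃ y₃)
      where
      identity₁ : ∀ c e x₁ y₁ x₂ y₂ x₃ y₃ →
        (x₁ * x₂ - c * (y₁ * y₂)) * x₃ - c * ((x₁ * y₂ + x₂ * y₁ + e * (y₁ * y₂)) * y₃)
        ≡ x₁ * (x₂ * x₃ - c * (y₂ * y₃)) - c * (y₁ * (x₂ * y₃ + x₃ * y₂ + e * (y₂ * y₃)))
      identity₁ = solve-∀
      identity₂ : ∀ c e x₁ y₁ x₂ y₂ x₃ y₃ →
        (x₁ * x₂ - c * (y₁ * y₂)) * y₃ + x₃ * (x₁ * y₂ + x₂ * y₁ + e * (y₁ * y₂)) + e * ((x₁ * y₂ + x₂ * y₁ + e * (y₁ * y₂)) * y₃)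
        ≡ x₁ * (x₂ * y₃ + x₃ * y₂ + e * (y₂ * y₃)) + (x₂ * x₃ - c * (y₂ * y₃)) * y₁ + e * (y₁ * (x₂ * y₃ + x₃ * y₂ + e * (y₂ * y₃)))
      identity₂ = solve-∀

    mulω-comm : ∀ α β → mulω D α β ≡ mulω D β α
    mulω-comm ⟨ x₁ , y₁ ⟩ ⟨ x₂ , y₂ ⟩ = cong₂ ⟨_,_⟩ (identity₁ c x₁ y₁ x₂ y₂) (identity₂ e x₁ y₁ x₂ y₂)
      where
      identity₁ : ∀ c x₁ y₁ x₂ y₂ → x₁ * x₂ - c * (y₁ * y₂) ≡ x₂ * x₁ - c * (y₂ * y₁)
      identity₁ = solve-∀
      identity₂ : ∀ e x₁ y₁ x₂ y₂ → x₁ * y₂ + x₂ * y₁ + e * (y₁ * y₂) ≡ x₂ * y₁ + x₁ * y₂ + e * (y₂ * y₁)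
      identity₂ = solve-∀

    mulω-identityˡ : ∀ α → mulω D 1ω α ≡ α
    mulω-identityˡ ⟨ x , y ⟩ = cong₂ ⟨_,_⟩ (identity₁ c x y) (identity₂ e x y)
      where
      identity₁ : ∀ c x y → + 1 * x - c * (+ 0 * y) ≡ x
      identity₁ = solve-∀
      identity₂ : ∀ e x y → + 1 * y + x * + 0 + e * (+ 0 * y) ≡ y
      identity₂ = solve-∀

    mulω-distribˡ : ∀ α β γ → mulω D α (addω β γ) ≡ addω (mulω D α β) (mulω D α γ)
    mulω-distribˡ ⟨ x₁ , y₁ ⟩ ⟨ x₂ , y₂ ⟩ ⟨ x₃ , y₃ ⟩ = cong₂ ⟨_,_⟩ (identity₁ c x₁ y₁ x₂ y₂ x₃ y₃) (identity₂ e x₁ y₁ x₂ y₂ x₃ y₃)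
      where
      identity₁ : ∀ c x₁ y₁ x₂ y₂ x₃ y₃ →
        x₁ * (x₂ + x₃) - c * (y₁ * (y₂ + y₃)) ≡ (x₁ * x₂ - c * (y₁ * y₂)) + (x₁ * x₃ - c * (y₁ * y₃))
      identity₁ = solve-∀
      identity₂ : ∀ e x₁ y₁ x₂ y₂ x₃ y₃ →
        x₁ * (y₂ + y₃) + (x₂ + x₃) * y₁ + e * (y₁ * (y₂ + y₃))
        ≡ (x₁ * y₂ + x₂ * y₁ + e * (y₁ * y₂)) + (x₁ * y₃ + x₃ * y₁ + e * (y₁ * y₃))
      identity₂ = solve-∀

    embed-*≡ : ∀ a b → embed (a * b) ≡ mulω D (embed a) (embed b)
    embed-*≡ a b = cong₂ ⟨_,_⟩ (identity₁ c a b) (identity₂ e a b)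
      where
      identity₁ : ∀ c a b → a * b ≡ a * b - c * (+ 0 * + 0)
      identity₁ = solve-∀
      identity₂ : ∀ e a b → + 0 ≡ a * + 0 + b * + 0 + e * (+ 0 * + 0)
      identity₂ = solve-∀

    normω-* : ∀ α β → normω D (mulω D α β) ≡ normω D α * normω D β
    normω-* ⟨ x₁ , y₁ ⟩ ⟨ x₂ , y₂ ⟩ = identity c e x₁ y₁ x₂ y₂
      where
      identity : ∀ c e x₁ y₁ x₂ y₂ →
        (x₁ * x₂ - c * (y₁ * y₂)) * (x₁ * x₂ - c * (y₁ * y₂))
          + e * ((x₁ * x₂ - c * (y₁ * y₂)) * (x₁ * y₂ + x₂ * y₁ + e * (y₁ * y₂)))
          + c * ((x₁ * y₂ + x₂ * y₁ + e * (y₁ * y₂)) * (x₁ * y₂ + x₂ * y₁ + e * (y₁ * y₂)))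
        ≡ (x₁ * x₁ + e * (x₁ * y₁) + c * (y₁ * y₁)) * (x₂ * x₂ + e * (x₂ * y₂) + c * (y₂ * y₂))
      identity = solve-∀

    normω-powω : ∀ {α} → normω D α ≡ + 1 → ∀ k → normω D (powω D α k) ≡ + 1
    normω-powω N≡1 zero = identity c e
      where
      identity : ∀ c e → + 1 * + 1 + e * (+ 1 * + 0) + c * (+ 0 * + 0) ≡ + 1
      identity = solve-∀
    normω-powω {α} N≡1 (suc k) = ≡.trans (normω-* α (powω D α k)) (cong₂ _*_ N≡1 (normω-powω N≡1 k))

    square-trace-norm : ∀ α → mulω D α α ≡ addω (mulω D (embed (traceω D α)) α) (negω (embed (normω D α)))
    square-trace-norm ⟨ x , y ⟩ = cong₂ ⟨_,_⟩ (identity₁ c e x y) (identity₂ c e x y)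
      where
      identity₁ : ∀ c e x y → x * x - c * (y * y) ≡ (+ 2 * x + e * y) * x - c * (+ 0 * y) + - (x * x + e * (x * y) + c * (y * y))
      identity₁ = solve-∀
      identity₂ : ∀ c e x y → x * y + x * y + e * (y * y) ≡ (+ 2 * x + e * y) * y + x * + 0 + e * (+ 0 * y) + - + 0
      identity₂ = solve-∀

    im-linear : ∀ a b α → im (addω (mulω D (embed a) α) (negω (embed b))) ≡ a * im α
    im-linear a b ⟨ x , y ⟩ = identity e a x y
      where
      identity : ∀ e a x y → a * y + x * + 0 + e * (+ 0 * y) + - + 0 ≡ a * y
      identity = solve-∀

    traceω-linear : ∀ a b α → traceω D (addω (mulω D (embed a) α) (negω (embed b))) ≡ a * traceω D α - + 2 * b
    traceω-linear a b ⟨ x , y ⟩ = identity c e a b x y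
      where
      identity : ∀ c e a b x y →
        + 2 * (a * x - c * (+ 0 * y) + - b) + e * (a * y + x * + 0 + e * (+ 0 * y) + - + 0) ≡ a * (+ 2 * x + e * y) - + 2 * b
      identity = solve-∀

infix 4 _≡_mod_
data _≡_mod_ : ℤ[ω] → ℤ[ω] → ℕ → Set where
  congruent : ∀ {x y x′ y′ n} → x ≡ℤ x′ mod n → y ≡ℤ y′ mod n → ⟨ x , y ⟩ ≡ ⟨ x′ , y′ ⟩ mod n

module _ {n : ℕ} where
  ≡mod-refl : ∀ {α} → α ≡ α mod n
  ≡mod-refl {⟨ _ , _ ⟩} = congruent ≡ℤ-refl ≡ℤ-refl

  ≡⇒≡mod : ∀ {α β} → α ≡ β → α ≡ β mod n
  ≡⇒≡mod ≡.refl = ≡mod-refl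

  ≡mod-sym : ∀ {α β} → α ≡ β mod n → β ≡ α mod n
  ≡mod-sym (congruent p q) = congruent (≡ℤ-sym p) (≡ℤ-sym q)

  ≡mod-trans : ∀ {α β γ} → α ≡ β mod n → β ≡ γ mod n → α ≡ γ mod n
  ≡mod-trans (congruent p q) (congruent p′ q′) = congruent (≡ℤ-trans p p′) (≡ℤ-trans q q′)

  addω-cong : ∀ {α α′ β β′} → α ≡ α′ mod n → β ≡ β′ mod n → addω α β ≡ addω α′ β′ mod n
  addω-cong (congruent p q) (congruent p′ q′) = congruent (+-cong-mod p p′) (+-cong-mod q q′)

  negω-cong : ∀ {α α′} → α ≡ α′ mod n → negω α ≡ negω α′ mod n
  negω-cong (congruent p q) = congruent (neg-cong-mod p) (neg-cong-mod q)

  mulω-cong : ∀ D {α α′ β β′} → α ≡ α′ mod n → β ≡ β′ mod n → mulω D α β ≡ mulω D α′ β′ mod n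
  mulω-cong D (congruent x₁ y₁) (congruent x₂ y₂) = congruent
    (+-cong-mod (*-cong-mod x₁ x₂) (neg-cong-mod (*-cong-mod (≡ℤ-refl {x = cst D}) (*-cong-mod y₁ y₂))))
    (+-cong-mod (+-cong-mod (*-cong-mod x₁ y₂) (*-cong-mod x₂ y₁)) (*-cong-mod (≡ℤ-refl {x = + D}) (*-cong-mod y₁ y₂)))

≡mod-0⇒≡ : ∀ {α β} → α ≡ β mod 0 → α ≡ β
≡mod-0⇒≡ (congruent p q) = cong₂ ⟨_,_⟩ (≡ℤ-mod-0⇒≡ p) (≡ℤ-mod-0⇒≡ q)

≡mod-∣ : ∀ {m n α β} → m ℕDiv.∣ n → α ≡ β mod n → α ≡ β mod m
≡mod-∣ {m} {n} m∣n (congruent (mod-witness p) (mod-witness q)) =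
  congruent (mod-witness (ℤS.∣-trans +m∣+n p)) (mod-witness (ℤS.∣-trans +m∣+n q))
  where
  +m∣+n : + m ℤS.∣ + n
  +m∣+n = ℤS.∣ᵤ⇒∣ m∣n

CongK⇒≡mod : ∀ {n α β} → CongK n α β → fromOK α ≡ fromOK β mod n
CongK⇒≡mod {n} {x₁ , y₁} {x₂ , y₂} (p , q) =
  congruent (mod-witness (ℤS.∣ᵤ⇒∣ {+ n} {x₁ ℤ.- x₂} p)) (mod-witness (ℤS.∣ᵤ⇒∣ {+ n} {y₁ ℤ.- y₂} q))

≡0-mod⇒multiple : ∀ D {n α} → α ≡ 0ω mod n → Σ ℤ[ω] λ γ → α ≡ mulω D (embed (+ n)) γ
≡0-mod⇒multiple D {n} (congruent {x} {y} (mod-witness (divides a x-0≡an)) (mod-witness (divides b y-0≡bn))) =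
  ⟨ a , b ⟩ , cong₂ ⟨_,_⟩ (≡.trans (≡.sym (ℤP.+-identityʳ x)) (≡.trans x-0≡an (identity₁ (cst D) a b (+ n))))
                          (≡.trans (≡.sym (ℤP.+-identityʳ y)) (≡.trans y-0≡bn (identity₂ (+ D) a b (+ n))))
  where
  open Data.Integer using (_+_; _*_; _-_)
  identity₁ : ∀ c a b n → a * n ≡ n * a - c * (+ 0 * b)
  identity₁ = solve-∀
  identity₂ : ∀ e a b n → b * n ≡ n * b + a * + 0 + e * (+ 0 * b)
  identity₂ = solve-∀

residueRing : ℕ → ℕ → CommutativeRing 0ℓ 0ℓ
residueRing D n = record
  { Carrier = ℤ[ω]
  ; _≈_ = λ α β → α ≡ β mod n
  ; _+_ = addω
  ; _*_ = mulω D
  ; -_ = negω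
  ; 0# = 0ω
  ; 1# = 1ω
  ; isCommutativeRing = record
    { isRing = record
      { +-isAbelianGroup = record
        { isGroup = record
          { isMonoid = record
            { isSemigroup = record
              { isMagma = record
                { isEquivalence = record { refl = ≡mod-refl ; sym = ≡mod-sym ; trans = ≡mod-trans }
                ; ∙-cong = addω-cong }
              ; assoc = λ α β γ → ≡⇒≡mod (addω-assoc α β γ) }
            ; identity = (λ α → ≡⇒≡mod (addω-identityˡ α))
                       , (λ α → ≡⇒≡mod (≡.trans (addω-comm α 0ω) (addω-identityˡ α))) }
          ; inverse = (λ α → ≡⇒≡mod (addω-inverseˡ α))
                    , (λ α → ≡⇒≡mod (≡.trans (addω-comm α (negω α)) (addω-inverseˡ α)))
          ; ⁻¹-cong = negω-cong }
        ; comm = λ α β → ≡⇒≡mod (addω-comm α β) }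
      ; *-cong = mulω-cong D
      ; *-assoc = λ α β γ → ≡⇒≡mod (mulω-assoc D α β γ)
      ; *-identity = (λ α → ≡⇒≡mod (mulω-identityˡ D α))
                   , (λ α → ≡⇒≡mod (≡.trans (mulω-comm D α 1ω) (mulω-identityˡ D α)))
      ; distrib = (λ α β γ → ≡⇒≡mod (mulω-distribˡ D α β γ))
                , (λ α β γ → ≡⇒≡mod (≡.trans (mulω-comm D (addω β γ) α)
                     (≡.trans (mulω-distribˡ D α β γ) (cong₂ addω (mulω-comm D α β) (mulω-comm D α γ))))) }
    ; *-comm = λ α β → ≡⇒≡mod (mulω-comm D α β) } }

embedding : ∀ D n → ℤ.+-*-rawRing -Raw-AlmostCommutative⟶ fromCommutativeRing (residueRing D n)
embedding D n = record
  { ⟦_⟧ = embed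
  ; +-homo = λ _ _ → ≡mod-refl
  ; *-homo = λ a b → ≡⇒≡mod (embed-*≡ D a b)
  ; -‿homo = λ _ → ≡mod-refl
  ; 0-homo = ≡mod-refl
  ; 1-homo = ≡mod-refl }

-- Most of this holds in any commutative ring.  It is stated for O_K/nO_K
-- because the ring solver embeds its integer coefficients via `embed`, which
-- sends + 0 and + 1 to 0# and 1# definitionally only in this concrete ring.
module Residue (D n : ℕ) where

  open CommutativeRing (residueRing D n) public
  open import Algebra.Properties.CommutativeSemiring.Exp commutativeSemiring public
    using (_^_; ^-homo-*; ^-assocʳ; ^-distrib-*; ^-congˡ)
  open import Algebra.Properties.Group +-group using (x∙y⁻¹≈ε⇒x≈y)
  open import Relation.Binary.Reasoning.Setoid setoid

  private
    coefficient≟ : ∀ a b → Maybe (embed a ≈ embed b)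
    coefficient≟ a b with a ℤ.≟ b
    ... | yes ≡.refl = just refl
    ... | no _ = nothing

  open import Algebra.Solver.Ring ℤ.+-*-rawRing _ (embedding D n) coefficient≟
    using (solve; _:=_; _:+_; _:*_; _:-_; :-_; con; Polynomial)

  private
    0ᴾ 1ᴾ 2ᴾ : ∀ {k} → Polynomial k
    0ᴾ = con (+ 0)
    1ᴾ = con (+ 1)
    2ᴾ = con (+ 2)

  2# : ℤ[ω]
  2# = embed (+ 2)

  Φ₃ : ℤ[ω] → ℤ[ω]
  Φ₃ x = x * x + x + 1#

  geometricSum : ℤ[ω] → ℕ → ℤ[ω]
  geometricSum z zero = 0#
  geometricSum z (suc k) = 1# + z * geometricSum z k

  embed-* : ∀ a b → embed (a ℤ.* b) ≈ embed a * embed b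
  embed-* a b = ≡⇒≡mod (embed-*≡ D a b)

  embed-^ : ∀ a k → embed (+ a) ^ k ≈ embed (+ (a ℕ.^ k))
  embed-^ a zero = refl
  embed-^ a (suc k) = begin
    embed (+ a) * embed (+ a) ^ k       ≈⟨ *-congˡ (embed-^ a k) ⟩
    embed (+ a) * embed (+ (a ℕ.^ k))   ≈⟨ embed-* (+ a) (+ (a ℕ.^ k)) ⟨
    embed (+ a ℤ.* + (a ℕ.^ k))         ≈⟨ ≡⇒≡mod (cong embed (ℤP.pos-* a (a ℕ.^ k))) ⟨
    embed (+ (a ℕ.* a ℕ.^ k))           ∎

  embed-odd : ∀ b → embed (+ (1 ℕ.+ 2 ℕ.* b)) ≈ 1# + 2# * embed (+ b)
  embed-odd b = trans (≡⇒≡mod (cong (λ z → embed (+ 1 ℤ.+ z)) (ℤP.pos-* 2 b))) (+-congˡ {1#} (embed-* (+ 2) (+ b)))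

  ∣⇒embed≈0 : ∀ {a} → + n ℤS.∣ a → embed a ≈ 0#
  ∣⇒embed≈0 {a} n∣a = congruent (mod-witness (subst (+ n ℤS.∣_) (≡.sym (ℤP.+-identityʳ a)) n∣a)) ≡ℤ-refl

  embed≈0⇒∣ : ∀ {a} → embed a ≈ 0# → + n ℤS.∣ a
  embed≈0⇒∣ {a} (congruent (mod-witness n∣a-0) _) = subst (+ n ℤS.∣_) (ℤP.+-identityʳ a) n∣a-0

  ^≡powω : ∀ α k → α ^ k ≡ powω D α k
  ^≡powω α zero = ≡.refl
  ^≡powω α (suc k) = cong (mulω D α) (^≡powω α k)

  norm-1⇒quadratic : ∀ {α} → normω D α ≡ + 1 → α * α ≈ embed (traceω D α) * α - 1#
  norm-1⇒quadratic {α} N≡1 =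
    ≡⇒≡mod (≡.trans (square-trace-norm D α) (cong (λ z → embed (traceω D α) * α - embed z) N≡1))

  ^-multiple : ∀ {x k} → x ^ k ≈ 1# → ∀ q → x ^ (q ℕ.* k) ≈ 1#
  ^-multiple x^k≈1 zero = refl
  ^-multiple {x} {k} x^k≈1 (suc q) = begin
    x ^ (k ℕ.+ q ℕ.* k)   ≈⟨ ^-homo-* x k (q ℕ.* k) ⟩
    x ^ k * x ^ (q ℕ.* k) ≈⟨ *-cong x^k≈1 (^-multiple x^k≈1 q) ⟩
    1# * 1#               ≈⟨ *-identityˡ 1# ⟩
    1#                    ∎

  ^-+-period : ∀ {x k} → x ^ k ≈ 1# → ∀ r q → x ^ (r ℕ.+ q ℕ.* k) ≈ x ^ r
  ^-+-period {x} {k} x^k≈1 r q = begin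
    x ^ (r ℕ.+ q ℕ.* k)    ≈⟨ ^-homo-* x r (q ℕ.* k) ⟩
    x ^ r * x ^ (q ℕ.* k)  ≈⟨ *-congˡ (^-multiple x^k≈1 q) ⟩
    x ^ r * 1#             ≈⟨ *-identityʳ (x ^ r) ⟩
    x ^ r                  ∎

  ^-inverse : ∀ {u v} → u * v ≈ 1# → ∀ k → u ^ k * v ^ k ≈ 1#
  ^-inverse uv≈1 zero = *-identityˡ 1#
  ^-inverse {u} {v} uv≈1 (suc k) = begin
    u * u ^ k * (v * v ^ k)   ≈⟨ solve 4 (λ u v p q → u :* p :* (v :* q) := u :* v :* (p :* q)) refl u v (u ^ k) (v ^ k) ⟩
    u * v * (u ^ k * v ^ k)   ≈⟨ *-cong uv≈1 (^-inverse uv≈1 k) ⟩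
    1# * 1#                   ≈⟨ *-identityˡ 1# ⟩
    1#                        ∎

  unit-cancel : ∀ {u v x} → u * v ≈ 1# → u * x ≈ 0# → x ≈ 0#
  unit-cancel {u} {v} {x} uv≈1 ux≈0 = begin
    x                              ≈⟨ solve 3 (λ u v x → x := v :* (u :* x) :+ (1ᴾ :- u :* v) :* x) refl u v x ⟩
    v * (u * x) + (1# - u * v) * x ≈⟨ +-cong (*-congˡ ux≈0) (*-congʳ (+-congˡ (-‿cong uv≈1))) ⟩
    v * 0# + (1# - 1#) * x         ≈⟨ solve 2 (λ v x → v :* 0ᴾ :+ (1ᴾ :- 1ᴾ) :* x := 0ᴾ) refl v x ⟩
    0#                             ∎

  geometricSum-cong : ∀ {x y} k → x ≈ y → geometricSum x k ≈ geometricSum y k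
  geometricSum-cong zero x≈y = refl
  geometricSum-cong (suc k) x≈y = +-congˡ (*-cong x≈y (geometricSum-cong k x≈y))

  geometricSum-+ : ∀ z k l → geometricSum z (k ℕ.+ l) ≈ geometricSum z k + z ^ k * geometricSum z l
  geometricSum-+ z zero l = solve 1 (λ g → g := 0ᴾ :+ 1ᴾ :* g) refl (geometricSum z l)
  geometricSum-+ z (suc k) l = begin
    1# + z * geometricSum z (k ℕ.+ l)                        ≈⟨ +-congˡ (*-congˡ (geometricSum-+ z k l)) ⟩
    1# + z * (geometricSum z k + z ^ k * geometricSum z l)  ≈⟨ solve 4 (λ z g p h → 1ᴾ :+ z :* (g :+ p :* h) := (1ᴾ :+ z :* g) :+ (z :* p) :* h) refl z (geometricSum z k) (z ^ k) (geometricSum z l) ⟩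
    1# + z * geometricSum z k + z * z ^ k * geometricSum z l ∎

  geometricSum-telescope : ∀ z k → (1# - z) * geometricSum z k ≈ 1# - z ^ k
  geometricSum-telescope z zero = solve 1 (λ z → (1ᴾ :- z) :* 0ᴾ := 1ᴾ :- 1ᴾ) refl z
  geometricSum-telescope z (suc k) = begin
    (1# - z) * (1# + z * geometricSum z k)        ≈⟨ solve 2 (λ z g → (1ᴾ :- z) :* (1ᴾ :+ z :* g) := (1ᴾ :- z) :+ z :* ((1ᴾ :- z) :* g)) refl z (geometricSum z k) ⟩
    (1# - z) + z * ((1# - z) * geometricSum z k) ≈⟨ +-congˡ (*-congˡ (geometricSum-telescope z k)) ⟩
    (1# - z) + z * (1# - z ^ k)                   ≈⟨ solve 2 (λ z p → (1ᴾ :- z) :+ z :* (1ᴾ :- p) := 1ᴾ :- z :* p) refl z (z ^ k) ⟩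
    1# - z * z ^ k                                 ∎

  geometricSum-periodic : ∀ {z k} → z ^ k ≈ 1# → ∀ q → geometricSum z (q ℕ.* k) ≈ embed (+ q) * geometricSum z k
  geometricSum-periodic {z} {k} z^k≈1 zero = solve 1 (λ g → 0ᴾ := 0ᴾ :* g) refl (geometricSum z k)
  geometricSum-periodic {z} {k} z^k≈1 (suc q) = begin
    geometricSum z (k ℕ.+ q ℕ.* k)                            ≈⟨ geometricSum-+ z k (q ℕ.* k) ⟩
    geometricSum z k + z ^ k * geometricSum z (q ℕ.* k)       ≈⟨ +-congˡ (*-cong z^k≈1 (geometricSum-periodic z^k≈1 q)) ⟩
    geometricSum z k + 1# * (embed (+ q) * geometricSum z k)  ≈⟨ solve 2 (λ g x → g :+ 1ᴾ :* (x :* g) := (1ᴾ :+ x) :* g) refl (geometricSum z k) (embed (+ q)) ⟩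
    embed (+ suc q) * geometricSum z k                         ∎

  geometricSum-1+2δ : ∀ δ k → Σ ℤ[ω] λ β → geometricSum (1# + 2# * δ) k ≈ embed (+ k) + 2# * β
  geometricSum-1+2δ δ zero = 0# , solve 0 (0ᴾ := 0ᴾ :+ 2ᴾ :* 0ᴾ) refl
  geometricSum-1+2δ δ (suc k) with geometricSum-1+2δ δ k
  ... | β , G≈k+2β = β + δ * embed (+ k) + 2# * δ * β , (begin
    1# + (1# + 2# * δ) * geometricSum (1# + 2# * δ) k          ≈⟨ +-congˡ (*-congˡ G≈k+2β) ⟩
    1# + (1# + 2# * δ) * (embed (+ k) + 2# * β)                ≈⟨ solve 3 (λ d b k → 1ᴾ :+ (1ᴾ :+ 2ᴾ :* d) :* (k :+ 2ᴾ :* b) := (1ᴾ :+ k) :+ 2ᴾ :* (b :+ d :* k :+ 2ᴾ :* d :* b)) refl δ β (embed (+ k)) ⟩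
    embed (+ suc k) + 2# * (β + δ * embed (+ k) + 2# * δ * β)  ∎)

  nilpotent-unit : ∀ {z k} → z ^ k ≈ 0# → (1# - z) * geometricSum z k ≈ 1#
  nilpotent-unit {z} {k} z^k≈0 = begin
    (1# - z) * geometricSum z k ≈⟨ geometricSum-telescope z k ⟩
    1# - z ^ k                  ≈⟨ +-congˡ (-‿cong z^k≈0) ⟩
    1# - 0#                     ≈⟨ solve 0 (1ᴾ :- 0ᴾ := 1ᴾ) refl ⟩
    1#                          ∎

  Φ₃-cong : ∀ {x y} → x ≈ y → Φ₃ x ≈ Φ₃ y
  Φ₃-cong x≈y = +-congʳ (+-cong (*-cong x≈y x≈y) x≈y)

  cube-1 : ∀ x → x ^ 3 - 1# ≈ (x - 1#) * Φ₃ x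
  cube-1 x = solve 1 (λ x → x :* (x :* (x :* 1ᴾ)) :- 1ᴾ := (x :- 1ᴾ) :* (x :* x :+ x :+ 1ᴾ)) refl x

  Φ₃≈0⇒^3≈1 : ∀ {x} → Φ₃ x ≈ 0# → x ^ 3 ≈ 1#
  Φ₃≈0⇒^3≈1 {x} Φ₃x≈0 = x∙y⁻¹≈ε⇒x≈y (x ^ 3) 1# (begin
    x ^ 3 - 1#        ≈⟨ cube-1 x ⟩
    (x - 1#) * Φ₃ x   ≈⟨ *-congˡ Φ₃x≈0 ⟩
    (x - 1#) * 0#     ≈⟨ zeroʳ (x - 1#) ⟩
    0#                ∎)

  geometricSum-Φ₃ : ∀ {x} → Φ₃ x ≈ 0# → ∀ q → geometricSum x (q ℕ.* 3) ≈ 0#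
  geometricSum-Φ₃ {x} Φ₃x≈0 q = begin
    geometricSum x (q ℕ.* 3)        ≈⟨ geometricSum-periodic (Φ₃≈0⇒^3≈1 Φ₃x≈0) q ⟩
    embed (+ q) * geometricSum x 3  ≈⟨ *-congˡ (solve 1 (λ x → 1ᴾ :+ x :* (1ᴾ :+ x :* (1ᴾ :+ x :* 0ᴾ)) := x :* x :+ x :+ 1ᴾ) refl x) ⟩
    embed (+ q) * Φ₃ x              ≈⟨ *-congˡ Φ₃x≈0 ⟩
    embed (+ q) * 0#                ≈⟨ zeroʳ (embed (+ q)) ⟩
    0#                              ∎

  Φ₃-^ : ∀ {x} → Φ₃ x ≈ 0# → ∀ {j} → ¬ 3 ℕDiv.∣ j → Φ₃ (x ^ j) ≈ 0#
  Φ₃-^ {x} Φ₃x≈0 {j} 3∤j with j ℕ.% 3 | ℕD.m≡m%n+[m/n]*n j 3 | ℕD.m%n<n j 3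
  ... | 0 | j≡ | _ = ⊥-elim (3∤j (divides (j ℕ./ 3) j≡))
  ... | 1 | j≡ | _ = begin
    Φ₃ (x ^ j)                      ≈⟨ Φ₃-cong (≡⇒≡mod (cong (x ^_) j≡)) ⟩
    Φ₃ (x ^ (1 ℕ.+ j ℕ./ 3 ℕ.* 3))  ≈⟨ Φ₃-cong (trans (^-+-period (Φ₃≈0⇒^3≈1 Φ₃x≈0) 1 (j ℕ./ 3)) (*-identityʳ x)) ⟩
    Φ₃ x                            ≈⟨ Φ₃x≈0 ⟩
    0#                              ∎
  ... | 2 | j≡ | _ = begin
    Φ₃ (x ^ j)                      ≈⟨ Φ₃-cong (≡⇒≡mod (cong (x ^_) j≡)) ⟩
    Φ₃ (x ^ (2 ℕ.+ j ℕ./ 3 ℕ.* 3))  ≈⟨ Φ₃-cong (^-+-period x³≈1 2 (j ℕ./ 3)) ⟩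
    Φ₃ (x * (x * 1#))               ≈⟨ solve 1 (λ x → (x :* (x :* 1ᴾ)) :* (x :* (x :* 1ᴾ)) :+ x :* (x :* 1ᴾ) :+ 1ᴾ := x :* (x :* (x :* (x :* 1ᴾ))) :+ x :* x :+ 1ᴾ) refl x ⟩
    x * x ^ 3 + x * x + 1#          ≈⟨ +-congʳ (+-congʳ (*-congˡ x³≈1)) ⟩
    x * 1# + x * x + 1#             ≈⟨ solve 1 (λ x → x :* 1ᴾ :+ x :* x :+ 1ᴾ := x :* x :+ x :+ 1ᴾ) refl x ⟩
    Φ₃ x                            ≈⟨ Φ₃x≈0 ⟩
    0#                              ∎
    where x³≈1 = Φ₃≈0⇒^3≈1 Φ₃x≈0
  ... | suc (suc (suc _)) | _ | s≤s (s≤s (s≤s ()))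

  module TwoAdic {ℓ} (2^ℓ≈0 : 2# ^ ℓ ≈ 0#) where

    odd-cancel : ∀ {β x} → (1# + 2# * β) * x ≈ 0# → x ≈ 0#
    odd-cancel {β} = unit-cancel (begin
      (1# + 2# * β) * geometricSum (- (2# * β)) ℓ       ≈⟨ *-congʳ (solve 2 (λ t b → 1ᴾ :+ t :* b := 1ᴾ :- :- (t :* b)) refl 2# β) ⟩
      (1# - - (2# * β)) * geometricSum (- (2# * β)) ℓ   ≈⟨ nilpotent-unit {k = ℓ} (begin
        (- (2# * β)) ^ ℓ     ≈⟨ ^-congˡ ℓ (solve 2 (λ t b → :- (t :* b) := t :* (:- b)) refl 2# β) ⟩
        (2# * - β) ^ ℓ       ≈⟨ ^-distrib-* 2# (- β) ℓ ⟩
        2# ^ ℓ * (- β) ^ ℓ   ≈⟨ *-congʳ 2^ℓ≈0 ⟩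
        0# * (- β) ^ ℓ       ≈⟨ zeroˡ ((- β) ^ ℓ) ⟩
        0#                   ∎) ⟩
      1#                                                  ∎)

    ≡1-mod-2-root-of-unity : ∀ {ψ δ} b → ψ ≈ 1# + 2# * δ → ψ ^ (1 ℕ.+ 2 ℕ.* b) ≈ 1# → ψ ≈ 1#
    ≡1-mod-2-root-of-unity {ψ} {δ} b ψ≈1+2δ ψ^o≈1 = sym (x∙y⁻¹≈ε⇒x≈y 1# ψ (odd-cancel (begin
      (1# + 2# * (embed (+ b) + β)) * (1# - ψ)  ≈⟨ *-congʳ G≈1+2[b+β] ⟨
      geometricSum ψ o * (1# - ψ)               ≈⟨ *-comm (geometricSum ψ o) (1# - ψ) ⟩
      (1# - ψ) * geometricSum ψ o               ≈⟨ geometricSum-telescope ψ o ⟩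
      1# - ψ ^ o                                ≈⟨ +-congˡ (-‿cong ψ^o≈1) ⟩
      1# - 1#                                   ≈⟨ -‿inverseʳ 1# ⟩
      0#                                        ∎)))
      where
      o : ℕ
      o = 1 ℕ.+ 2 ℕ.* b
      β : ℤ[ω]
      β = proj₁ (geometricSum-1+2δ δ o)
      G≈1+2[b+β] : geometricSum ψ o ≈ 1# + 2# * (embed (+ b) + β)
      G≈1+2[b+β] = begin
        geometricSum ψ o                ≈⟨ geometricSum-cong o ψ≈1+2δ ⟩
        geometricSum (1# + 2# * δ) o    ≈⟨ proj₂ (geometricSum-1+2δ δ o) ⟩
        embed (+ o) + 2# * β            ≈⟨ +-congʳ (embed-odd b) ⟩
        1# + 2# * embed (+ b) + 2# * β  ≈⟨ solve 3 (λ t c b → 1ᴾ :+ t :* c :+ t :* b := 1ᴾ :+ t :* (c :+ b)) refl 2# (embed (+ b)) β ⟩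
        1# + 2# * (embed (+ b) + β)     ∎

    Φ₃-lift : ∀ {η γ} b → Φ₃ η ≈ 2# * γ → η ^ (1 ℕ.+ 2 ℕ.* b) ≈ 1# → Φ₃ η ≈ 0#
    Φ₃-lift {η} {γ} b Φ₃η≈2γ η^o≈1 = odd-cancel (begin
      (1# + 2# * (η - γ)) * Φ₃ η                        ≈⟨ solve 2 (λ h g → (1ᴾ :+ 2ᴾ :* (h :- g)) :* (h :* h :+ h :+ 1ᴾ) := :- h :* ((h :- 1ᴾ) :* (h :* h :+ h :+ 1ᴾ)) :+ (h :* h :+ h :+ 1ᴾ) :* ((h :* h :+ h :+ 1ᴾ) :- 2ᴾ :* g)) refl η γ ⟩
      - η * ((η - 1#) * Φ₃ η) + Φ₃ η * (Φ₃ η - 2# * γ)  ≈⟨ +-cong (*-congˡ [η-1]Φ₃η≈0) (*-congˡ (+-congʳ Φ₃η≈2γ)) ⟩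
      - η * 0# + Φ₃ η * (2# * γ - 2# * γ)               ≈⟨ solve 3 (λ h x y → :- h :* 0ᴾ :+ x :* (y :- y) := 0ᴾ) refl η (Φ₃ η) (2# * γ) ⟩
      0#                                                ∎)
      where
      o : ℕ
      o = 1 ℕ.+ 2 ℕ.* b
      η³≈1+2[η-1]γ : η ^ 3 ≈ 1# + 2# * ((η - 1#) * γ)
      η³≈1+2[η-1]γ = begin
        η ^ 3                     ≈⟨ solve 1 (λ h → h :* (h :* (h :* 1ᴾ)) := 1ᴾ :+ (h :- 1ᴾ) :* (h :* h :+ h :+ 1ᴾ)) refl η ⟩
        1# + (η - 1#) * Φ₃ η      ≈⟨ +-congˡ (*-congˡ Φ₃η≈2γ) ⟩
        1# + (η - 1#) * (2# * γ)  ≈⟨ solve 2 (λ h g → 1ᴾ :+ (h :- 1ᴾ) :* (2ᴾ :* g) := 1ᴾ :+ 2ᴾ :* ((h :- 1ᴾ) :* g)) refl η γ ⟩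
        1# + 2# * ((η - 1#) * γ)  ∎
      η³≈1 : η ^ 3 ≈ 1#
      η³≈1 = ≡1-mod-2-root-of-unity b η³≈1+2[η-1]γ (trans (^-assocʳ η 3 o) (^-multiple {η} {o} η^o≈1 3))
      [η-1]Φ₃η≈0 : (η - 1#) * Φ₃ η ≈ 0#
      [η-1]Φ₃η≈0 = begin
        (η - 1#) * Φ₃ η  ≈⟨ cube-1 η ⟨
        η ^ 3 - 1#       ≈⟨ +-congʳ η³≈1 ⟩
        1# - 1#          ≈⟨ -‿inverseʳ 1# ⟩
        0#               ∎

  module Quadratic {η : ℤ[ω]} {s : ℤ} (η²≈sη-1 : η * η ≈ embed s * η - 1#) where

    conjugate-inverse : η * (embed s - η) ≈ 1#
    conjugate-inverse = begin
      η * (embed s - η)                ≈⟨ solve 2 (λ h s → h :* (s :- h) := (s :* h :- 1ᴾ) :- h :* h :+ 1ᴾ) refl η (embed s) ⟩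
      (embed s * η - 1#) - η * η + 1#  ≈⟨ +-congʳ (+-congʳ (sym η²≈sη-1)) ⟩
      η * η - η * η + 1#               ≈⟨ solve 1 (λ h → h :* h :- h :* h :+ 1ᴾ := 1ᴾ) refl η ⟩
      1#                               ∎

    sη≈η²+1 : embed s * η ≈ η * η + 1#
    sη≈η²+1 = begin
      embed s * η              ≈⟨ solve 2 (λ h s → s :* h := (s :* h :- 1ᴾ) :+ 1ᴾ) refl η (embed s) ⟩
      (embed s * η - 1#) + 1#  ≈⟨ +-congʳ (sym η²≈sη-1) ⟩
      η * η + 1#               ∎

    Φ₃≈[s+1]η : Φ₃ η ≈ embed (s ℤ.+ + 1) * η
    Φ₃≈[s+1]η = begin
      η * η + η + 1#             ≈⟨ +-congʳ (+-congʳ η²≈sη-1) ⟩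
      embed s * η - 1# + η + 1#  ≈⟨ solve 2 (λ h s → s :* h :- 1ᴾ :+ h :+ 1ᴾ := (s :+ 1ᴾ) :* h) refl η (embed s) ⟩
      (embed s + 1#) * η         ∎

    ^-lucasU : ∀ k → η ^ suc k ≈ embed (lucasU s (suc k)) * η - embed (lucasU s k)
    ^-lucasU zero = solve 1 (λ h → h :* 1ᴾ := 1ᴾ :* h :- 0ᴾ) refl η
    ^-lucasU (suc k) = begin
      η * η ^ suc k                     ≈⟨ *-congˡ (^-lucasU k) ⟩
      η * (U₁ * η - U₀)                 ≈⟨ solve 3 (λ h a b → h :* (a :* h :- b) := a :* (h :* h) :- b :* h) refl η U₁ U₀ ⟩
      U₁ * (η * η) - U₀ * η             ≈⟨ +-congʳ (*-congˡ η²≈sη-1) ⟩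
      U₁ * (embed s * η - 1#) - U₀ * η  ≈⟨ solve 4 (λ h a b s → a :* (s :* h :- 1ᴾ) :- b :* h := (s :* a :- b) :* h :- a) refl η U₁ U₀ (embed s) ⟩
      (embed s * U₁ - U₀) * η - U₁      ≈⟨ +-congʳ (*-congʳ (+-congʳ (embed-* s (lucasU s (suc k))))) ⟨
      embed (lucasU s (2 ℕ.+ k)) * η - U₁ ∎
      where
      U₁ U₀ : ℤ[ω]
      U₁ = embed (lucasU s (suc k))
      U₀ = embed (lucasU s k)

    ^-lucasSum : ∀ m → η ^ m * embed (lucasSum s m) ≈ geometricSum η (1 ℕ.+ 2 ℕ.* m)
    ^-lucasSum zero = solve 1 (λ h → 1ᴾ :* 1ᴾ := 1ᴾ :+ h :* 0ᴾ) refl η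
    ^-lucasSum (suc zero) = begin
      η * 1# * embed (lucasSum s 1)  ≈⟨ *-congˡ (≡⇒≡mod (cong embed (lucasSum-one s))) ⟩
      η * 1# * (embed s + 1#)        ≈⟨ solve 2 (λ h s → h :* 1ᴾ :* (s :+ 1ᴾ) := s :* h :+ h) refl η (embed s) ⟩
      embed s * η + η                ≈⟨ +-congʳ sη≈η²+1 ⟩
      η * η + 1# + η                 ≈⟨ solve 1 (λ h → h :* h :+ 1ᴾ :+ h := 1ᴾ :+ h :* (1ᴾ :+ h :* (1ᴾ :+ h :* 0ᴾ))) refl η ⟩
      geometricSum η 3               ∎
    ^-lucasSum (suc (suc m)) = begin
      η ^ (2 ℕ.+ m) * embed (lucasSum s (2 ℕ.+ m))
        ≈⟨ *-congˡ (≡⇒≡mod (cong embed (lucasSum-rec s m))) ⟩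
      η * (η * η ^ m) * embed (s ℤ.* lucasSum s (suc m) ℤ.- lucasSum s m)
        ≈⟨ *-congˡ (+-congʳ (embed-* s (lucasSum s (suc m)))) ⟩
      η * (η * η ^ m) * (embed s * E₁ - E₀)
        ≈⟨ solve 5 (λ h p s e₁ e₀ → h :* (h :* p) :* (s :* e₁ :- e₀) := s :* h :* (h :* p :* e₁) :- h :* h :* (p :* e₀)) refl η (η ^ m) (embed s) E₁ E₀ ⟩
      embed s * η * (η * η ^ m * E₁) - η * η * (η ^ m * E₀)
        ≈⟨ +-cong (*-cong sη≈η²+1 (^-lucasSum (suc m))) (-‿cong (*-congˡ (^-lucasSum m))) ⟩
      (η * η + 1#) * geometricSum η (1 ℕ.+ 2 ℕ.* suc m) - η * η * G₀
        ≈⟨ +-congʳ (*-congˡ (≡⇒≡mod (cong (λ k → geometricSum η (1 ℕ.+ k)) (ℕP.*-suc 2 m)))) ⟩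
      (η * η + 1#) * geometricSum η (2 ℕ.+ (1 ℕ.+ 2 ℕ.* m)) - η * η * G₀
        ≈⟨ solve 2 (λ h g → (h :* h :+ 1ᴾ) :* (1ᴾ :+ h :* (1ᴾ :+ h :* g)) :- h :* h :* g := 1ᴾ :+ h :* (1ᴾ :+ h :* (1ᴾ :+ h :* (1ᴾ :+ h :* g)))) refl η G₀ ⟩
      geometricSum η (4 ℕ.+ (1 ℕ.+ 2 ℕ.* m))
        ≈⟨ ≡⇒≡mod (cong (λ k → geometricSum η (1 ℕ.+ k)) (≡.trans (ℕP.*-suc 2 (suc m)) (cong (2 ℕ.+_) (ℕP.*-suc 2 m)))) ⟨
      geometricSum η (1 ℕ.+ 2 ℕ.* (2 ℕ.+ m)) ∎
      where
      E₁ E₀ G₀ : ℤ[ω]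
      E₁ = embed (lucasSum s (suc m))
      E₀ = embed (lucasSum s m)
      G₀ = geometricSum η (1 ℕ.+ 2 ℕ.* m)

    lucasSum≈0 : ∀ m → geometricSum η (1 ℕ.+ 2 ℕ.* m) ≈ 0# → embed (lucasSum s m) ≈ 0#
    lucasSum≈0 m G≈0 = unit-cancel (^-inverse conjugate-inverse m) (trans (^-lucasSum m) G≈0)

    lucasSum≈0-of-order : ∀ {k m} → η ^ k ≈ 1# → n ℕ.* k ℕDiv.∣ 1 ℕ.+ 2 ℕ.* m → embed (lucasSum s m) ≈ 0#
    lucasSum≈0-of-order {k} {m} η^k≈1 (divides q o≡q[nk]) = lucasSum≈0 m (begin
      geometricSum η (1 ℕ.+ 2 ℕ.* m)          ≈⟨ ≡⇒≡mod (cong (geometricSum η) (≡.trans o≡q[nk] (≡.sym (ℕP.*-assoc q n k)))) ⟩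
      geometricSum η (q ℕ.* n ℕ.* k)          ≈⟨ geometricSum-periodic η^k≈1 (q ℕ.* n) ⟩
      embed (+ (q ℕ.* n)) * geometricSum η k  ≈⟨ *-congʳ (∣⇒embed≈0 (ℤS.∣ᵤ⇒∣ {+ n} {+ (q ℕ.* n)} (ℕDiv.n∣m*n q))) ⟩
      0# * geometricSum η k                   ≈⟨ zeroˡ (geometricSum η k) ⟩
      0#                                      ∎)

    lucasSum≈0-of-Φ₃ : ∀ {m} → Φ₃ η ≈ 0# → 3 ℕDiv.∣ 1 ℕ.+ 2 ℕ.* m → embed (lucasSum s m) ≈ 0#
    lucasSum≈0-of-Φ₃ {m} Φ₃η≈0 (divides q o≡3q) =
      lucasSum≈0 m (trans (≡⇒≡mod (cong (geometricSum η) o≡3q)) (geometricSum-Φ₃ Φ₃η≈0 q))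

-- Congruence modulo 0 is equality, so identities proved in residueRing D 0
-- hold in ℤ[ω] itself.
module Exact (D : ℕ) where
  open Residue D 0

  powω-* : ∀ α j k → powω D α (j ℕ.* k) ≡ powω D (powω D α j) k
  powω-* α j k = begin
    powω D α (j ℕ.* k)     ≡⟨ ^≡powω α (j ℕ.* k) ⟨
    α ^ (j ℕ.* k)          ≡⟨ ≡mod-0⇒≡ (^-assocʳ α j k) ⟨
    (α ^ j) ^ k            ≡⟨ ^≡powω (α ^ j) k ⟩
    powω D (α ^ j) k       ≡⟨ cong (λ β → powω D β k) (^≡powω α j) ⟩
    powω D (powω D α j) k  ∎
    where open ≡-Reasoning

  module _ {α} (N≡1 : normω D α ≡ + 1) where
    private
      t : ℤ
      t = traceω D α

    powω-lucasU : ∀ k → powω D α (suc k) ≡ addω (mulω D (embed (lucasU t (suc k))) α) (negω (embed (lucasU t k)))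
    powω-lucasU k = ≡.trans (≡.sym (^≡powω α (suc k))) (≡mod-0⇒≡ (Quadratic.^-lucasU (norm-1⇒quadratic N≡1) k))

    im-powω : ∀ k → im (powω D α k) ≡ lucasU t k ℤ.* im α
    im-powω zero = ≡.sym (ℤP.*-zeroˡ (im α))
    im-powω (suc k) = ≡.trans (cong im (powω-lucasU k)) (im-linear D _ _ α)

    traceω-powω : ∀ k → traceω D (powω D α (suc k)) ≡ lucasU t (suc k) ℤ.* t ℤ.- + 2 ℤ.* lucasU t k
    traceω-powω k = ≡.trans (cong (traceω D) (powω-lucasU k)) (traceω-linear D _ _ α)

-- The fundamental unit

module FundamentalUnit {D : ℕ} (qd : IsRealQuadDisc D) {ε : OK} (isEps : IsEps D ε) where
  open Data.Integer using (_+_; _*_; _-_)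
  open Exact D using (powω-*; im-powω; traceω-powω)

  ε′ : ℤ[ω]
  ε′ = fromOK ε

  η : ℕ → ℤ[ω]
  η j = powω D ε′ j

  s : ℕ → ℤ
  s j = traceω D (η j)

  t : ℤ
  t = traceω D ε′

  N[ε]≡1 : normω D ε′ ≡ + 1
  N[ε]≡1 = proj₁ (proj₂ isEps)

  N[η]≡1 : ∀ j → normω D (η j) ≡ + 1
  N[η]≡1 = normω-powω D N[ε]≡1

  private
    x y : ℤ
    x = proj₁ ε
    y = proj₂ ε

  -- 2(ε − 1) = A + y√D, so GtK D ε oneK says that A + y√D > 0.
  A : ℤ
  A = + 2 * (x - + 1) + (y - + 0) * + D

  private
    norm-relation : (y - + 0) * (y - + 0) * + D ≡ A * A + + 4 * A
    norm-relation = ℤP.i-j≡0⇒i≡j _ _ (begin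
      (y - + 0) * (y - + 0) * + D - (A * A + + 4 * A)
        ≡⟨ identity x y (cst D) (+ D) ⟩
      + 4 * (+ 1 - normω D ε′) + y * y * (+ 4 * cst D - (+ D * + D - + D))
        ≡⟨ cong₂ (λ N c → + 4 * (+ 1 - N) + y * y * (c - (+ D * + D - + D))) N[ε]≡1 (4cst≡D²-D D qd) ⟩
      + 4 * (+ 1 - + 1) + y * y * ((+ D * + D - + D) - (+ D * + D - + D))
        ≡⟨ vanish y (+ D * + D - + D) ⟩
      + 0 ∎)
      where
      open ≡-Reasoning
      identity : ∀ x y c e →
        (y - + 0) * (y - + 0) * e - ((+ 2 * (x - + 1) + (y - + 0) * e) * (+ 2 * (x - + 1) + (y - + 0) * e) + + 4 * (+ 2 * (x - + 1) + (y - + 0) * e))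
        ≡ + 4 * (+ 1 - (x * x + e * (x * y) + c * (y * y))) + y * y * (+ 4 * c - (e * e - e))
      identity = solve-∀
      vanish : ∀ y w → + 4 * (+ 1 - + 1) + y * y * (w - w) ≡ + 0
      vanish = solve-∀

    0≤A×y≢0 : + 0 ℤ.≤ A × y - + 0 ≢ + 0
    0≤A×y≢0 = posSqrt-unit norm-relation (proj₁ (proj₂ (proj₂ isEps)))

  im-ε≢0 : im ε′ ≢ + 0
  im-ε≢0 y≡0 = proj₂ 0≤A×y≢0 (≡.trans (ℤP.+-identityʳ y) y≡0)

  t≡2+∣A∣ : t ≡ + (2 ℕ.+ ℤ.∣ A ∣)
  t≡2+∣A∣ = begin
    + 2 * x + + D * y  ≡⟨ identity x y (+ D) ⟩
    + 2 + A            ≡⟨ cong (λ z → + 2 + z) (ℤP.0≤i⇒+∣i∣≡i (proj₁ 0≤A×y≢0)) ⟨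
    + 2 + + ℤ.∣ A ∣    ≡⟨ ℤP.pos-+ 2 ℤ.∣ A ∣ ⟨
    + (2 ℕ.+ ℤ.∣ A ∣)  ∎
    where
    open ≡-Reasoning
    identity : ∀ x y e → + 2 * x + e * y ≡ + 2 + (+ 2 * (x - + 1) + (y - + 0) * e)
    identity = solve-∀

  im-η≢0 : ∀ j → im (η (suc j)) ≢ + 0
  im-η≢0 j f≡0 with ℤP.i*j≡0⇒i≡0∨j≡0 _ (≡.trans (≡.sym (im-powω N[ε]≡1 (suc j))) f≡0)
  ... | inj₁ U≡0 = lucasU-nonzero ℤ.∣ A ∣ j (subst (λ t → lucasU t (suc j) ≡ + 0) t≡2+∣A∣ U≡0)
  ... | inj₂ y≡0 = im-ε≢0 y≡0

  rK≡lucasU : ∀ j k → rK D ε (suc j) k ≡ lucasU (s (suc j)) k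
  rK≡lucasU j k = begin
    quotℤ (fK D ε (suc j ℕ.* k)) (fK D ε (suc j))                   ≡⟨ cong₂ quotℤ f[jk]≡ (f≡ (suc j)) ⟩
    quotℤ (lucasU (s (suc j)) k * im (η (suc j))) (im (η (suc j)))  ≡⟨ quotℤ-exact _ _ (im-η≢0 j) ⟩
    lucasU (s (suc j)) k                                            ∎
    where
    open ≡-Reasoning
    f≡ : ∀ i → fK D ε i ≡ im (η i)
    f≡ i = cong im (fromOK-powK D ε i)
    f[jk]≡ : fK D ε (suc j ℕ.* k) ≡ lucasU (s (suc j)) k * im (η (suc j))
    f[jk]≡ = ≡.trans (f≡ (suc j ℕ.* k)) (≡.trans (cong im (powω-* ε′ (suc j) k)) (im-powω (N[η]≡1 (suc j)) k))

  dK≡lucasSum : ∀ j m → dK D ε (suc j) m ≡ lucasSum (s (suc j)) m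
  dK≡lucasSum j m = cong₂ _+_ (rK≡lucasU j (suc m)) (rK≡lucasU j m)

  d₁K≡t+1 : d₁K D ε ≡ t + + 1
  d₁K≡t+1 = ≡.trans (dK≡lucasSum 0 1) (≡.trans (lucasSum-one (s 1)) (cong (λ α → traceω D α + + 1) ε′1≡ε′))
    where
    ε′1≡ε′ : mulω D ε′ 1ω ≡ ε′
    ε′1≡ε′ = ≡.trans (mulω-comm D ε′ 1ω) (mulω-identityˡ D ε′)

  2∣t⇒2∣s : + 2 ℤS.∣ t → ∀ j → + 2 ℤS.∣ s (suc j)
  2∣t⇒2∣s 2∣t j = subst (+ 2 ℤS.∣_) (≡.sym (traceω-powω N[ε]≡1 j))
    (ℤS.∣m∣n⇒∣m-n (ℤS.∣n⇒∣m*n (lucasU t (suc j)) 2∣t) (ℤS.∣m⇒∣m*n (lucasU t j) (ℤS.∣-refl {+ 2})))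

  η^o≡1 : ∀ {d r} j o → IsOrderMod D d ε r → r ℕDiv.∣ j ℕ.* o → powω D (η j) o ≡ 1ω mod d
  η^o≡1 {d} {r} j o (_ , ε^r≡1 , _) (divides q jo≡qr) = ≡mod-trans
    (≡⇒≡mod (≡.trans (≡.sym (powω-* ε′ j o)) (≡.trans (cong (powω D ε′) jo≡qr) (≡.sym (R.^≡powω ε′ (q ℕ.* r))))))
    (R.^-multiple (≡mod-trans (≡⇒≡mod (≡.trans (R.^≡powω ε′ r) (≡.sym (fromOK-powK D ε r)))) (CongK⇒≡mod ε^r≡1)) q)
    where module R = Residue D d

  o∣lucasSum : ∀ {d r o₁ o₂} j m → IsOrderMod D d ε r → r ℕDiv.∣ j ℕ.* o₂ → o₁ ℕDiv.∣ d →
             o₁ ℕ.* o₂ ℕDiv.∣ 1 ℕ.+ 2 ℕ.* m → + o₁ ℤS.∣ lucasSum (s j) m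
  o∣lucasSum {o₁ = o₁} {o₂} j m ord r∣jo₂ o₁∣d o₁o₂∣o =
    embed≈0⇒∣ (lucasSum≈0-of-order {m = m} (≡mod-trans (≡⇒≡mod (^≡powω (η j) o₂)) (≡mod-∣ o₁∣d (η^o≡1 j o₂ ord r∣jo₂))) o₁o₂∣o)
    where
    open Residue D o₁ using (embed≈0⇒∣; ^≡powω; norm-1⇒quadratic)
    open Residue.Quadratic D o₁ (norm-1⇒quadratic {η j} (N[η]≡1 j))

  2^ℓ∣lucasSum : ∀ {d r} j m b ℓ → IsOrderMod D d ε r → r ℕDiv.∣ j ℕ.* (1 ℕ.+ 2 ℕ.* b) → 2 ℕ.^ ℓ ℕDiv.∣ d →
             + 2 ℤS.∣ t + + 1 → ¬ 3 ℕDiv.∣ j → 3 ℕDiv.∣ 1 ℕ.+ 2 ℕ.* m → + (2 ℕ.^ ℓ) ℤS.∣ lucasSum (s j) m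
  2^ℓ∣lucasSum j m b ℓ ord r∣jo₂ 2^ℓ∣d 2∣t+1 3∤j 3∣o =
    M.embed≈0⇒∣ (Q.lucasSum≈0-of-Φ₃ {m} (T.Φ₃-lift b Φ₃η≈2γ η^o₂≈1) 3∣o)
    where
    module M = Residue D (2 ℕ.^ ℓ)
    module Q = M.Quadratic (M.norm-1⇒quadratic {η j} (N[η]≡1 j))
    module T = M.TwoAdic {ℓ} (M.trans (M.embed-^ 2 ℓ) (M.∣⇒embed≈0 (ℤS.∣-refl {+ (2 ℕ.^ ℓ)})))
    module M₂ = Residue D 2
    Φ₃ε≈0 : M₂.Φ₃ ε′ ≡ 0ω mod 2
    Φ₃ε≈0 = begin
      M₂.Φ₃ ε′                 ≈⟨ M₂.Quadratic.Φ₃≈[s+1]η {ε′} {t} (M₂.norm-1⇒quadratic {ε′} N[ε]≡1) ⟩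
      embed (t + + 1) M₂.* ε′  ≈⟨ M₂.*-congʳ {ε′} (M₂.∣⇒embed≈0 2∣t+1) ⟩
      0ω M₂.* ε′               ≈⟨ M₂.zeroˡ ε′ ⟩
      0ω                       ∎
      where open import Relation.Binary.Reasoning.Setoid M₂.setoid
    Φ₃η≈0 : M₂.Φ₃ (η j) ≡ 0ω mod 2
    Φ₃η≈0 = M₂.trans (M₂.Φ₃-cong (≡⇒≡mod (≡.sym (M₂.^≡powω ε′ j)))) (M₂.Φ₃-^ Φ₃ε≈0 3∤j)
    γ : ℤ[ω]
    γ = proj₁ (≡0-mod⇒multiple D Φ₃η≈0)
    Φ₃η≈2γ : M.Φ₃ (η j) ≡ M.2# M.* γ mod (2 ℕ.^ ℓ)
    Φ₃η≈2γ = ≡⇒≡mod (proj₂ (≡0-mod⇒multiple D Φ₃η≈0))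
    η^o₂≈1 : η j M.^ (1 ℕ.+ 2 ℕ.* b) ≡ 1ω mod (2 ℕ.^ ℓ)
    η^o₂≈1 = ≡mod-trans (≡⇒≡mod (M.^≡powω (η j) (1 ℕ.+ 2 ℕ.* b))) (≡mod-∣ 2^ℓ∣d (η^o≡1 j (1 ℕ.+ 2 ℕ.* b) ord r∣jo₂))

  d∣lucasSum : ∀ {d r} ℓ a b j m → IsOrderMod D d ε r → d ≡ 2 ℕ.^ ℓ ℕ.* (2 ℕ.* a ℕ.+ 1) →
    r ℕDiv.∣ j ℕ.* (2 ℕ.* b ℕ.+ 1) → (2 ℕ.* a ℕ.+ 1) ℕ.* (2 ℕ.* b ℕ.+ 1) ℕDiv.∣ 2 ℕ.* m ℕ.+ 1 →
    (2 ℕDiv.∣ d → + 2 ℤS.∣ t + + 1 × Coprime j 3 × 3 ℕDiv.∣ 2 ℕ.* m ℕ.+ 1) →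
    d ℕDiv.∣ ℤ.∣ lucasSum (s j) m ∣
  d∣lucasSum {d} {r} ℓ a b j m ord d≡ r∣jo₂ o₁o₂∣o d-even =
    subst (ℕDiv._∣ _) (≡.sym d≡) (coprime⇒*-∣ (2^ℓ-coprime-odd ℓ a) (two-adic ℓ 2^ℓ∣d) (ℤS.∣⇒∣ᵤ odd))
    where
    odd≡ : ∀ k → 2 ℕ.* k ℕ.+ 1 ≡ 1 ℕ.+ 2 ℕ.* k
    odd≡ k = ℕP.+-comm (2 ℕ.* k) 1
    2^ℓ∣d : 2 ℕ.^ ℓ ℕDiv.∣ d
    2^ℓ∣d = divides (2 ℕ.* a ℕ.+ 1) (≡.trans d≡ (ℕP.*-comm (2 ℕ.^ ℓ) _))
    odd : + (2 ℕ.* a ℕ.+ 1) ℤS.∣ lucasSum (s j) m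
    odd = o∣lucasSum j m ord r∣jo₂ (divides (2 ℕ.^ ℓ) d≡)
      (subst ((2 ℕ.* a ℕ.+ 1) ℕ.* (2 ℕ.* b ℕ.+ 1) ℕDiv.∣_) (odd≡ m) o₁o₂∣o)
    two-adic : ∀ ℓ′ → 2 ℕ.^ ℓ′ ℕDiv.∣ d → 2 ℕ.^ ℓ′ ℕDiv.∣ ℤ.∣ lucasSum (s j) m ∣
    two-adic zero _ = ℕDiv.1∣ _
    two-adic (suc ℓ′) 2^ℓ′⁺¹∣d with d-even (ℕDiv.∣-trans (ℕDiv.m∣m*n (2 ℕ.^ ℓ′)) 2^ℓ′⁺¹∣d)
    ... | 2∣t+1 , j⊥3 , 3∣o = ℤS.∣⇒∣ᵤ (2^ℓ∣lucasSum j m b (suc ℓ′) ord (subst (λ k → r ℕDiv.∣ j ℕ.* k) (odd≡ b) r∣jo₂)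
      2^ℓ′⁺¹∣d 2∣t+1 (λ 3∣j → case j⊥3 (3∣j , ℕDiv.∣-refl) of λ ()) (subst (3 ℕDiv.∣_) (odd≡ m) 3∣o))

theorem6p13 : (D : ℕ) → IsRealQuadDisc D → (ε : OK) → IsEps D ε →
    (d : ℕ) → 0 ℕ.< d → (r : ℕ) → IsOrderMod D d ε r →
    (ℓ₁ a ℓ₂ b : ℕ) → d ≡ 2 ℕ.^ ℓ₁ ℕ.* (2 ℕ.* a ℕ.+ 1) → r ≡ 2 ℕ.^ ℓ₂ ℕ.* (2 ℕ.* b ℕ.+ 1) →
    (j m : ℕ) → 0 ℕ.< j → 0 ℕ.< m →
    (2 ℕ.^ (ℓ₁ ⊔ ℓ₂)) ℕDiv.∣ j →
    ((2 ℕ.* a ℕ.+ 1) ℕ.* (2 ℕ.* b ℕ.+ 1)) ℕDiv.∣ (2 ℕ.* m ℕ.+ 1) →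
    (2 ℕDiv.∣ d → Coprime j 3 × 3 ℕDiv.∣ (2 ℕ.* m ℕ.+ 1)) →
    ((+ 2) ℤDiv.∣ d₁K D ε → (+ d) ℤDiv.∣ dK D ε j m)
    × (¬ ((+ 2) ℤDiv.∣ d₁K D ε) → ((+ d) ℤDiv.∣ dK D ε j m ⇔ (¬ (2 ℕDiv.∣ d))))
theorem6p13 D qd ε isEps d _ r ord ℓ₁ a ℓ₂ b d≡ r≡ zero m () _ _ _ _
theorem6p13 D qd ε isEps d _ r ord ℓ₁ a ℓ₂ b d≡ r≡ (suc j) m _ _ 2^ℓ∣j o₁o₂∣o d-even =
  (λ 2∣d₁ → to-dK (d∣E (λ 2∣d → 2∣d₁⇒2∣t+1 2∣d₁ , d-even 2∣d))) ,
  λ ¬2∣d₁ → mk⇔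
    (λ d∣dK 2∣d → lucasSum-odd (2∣t⇒2∣s (¬2∣d₁⇒2∣t ¬2∣d₁) j) m (ℤS.∣ᵤ⇒∣ (ℕDiv.∣-trans 2∣d (from-dK d∣dK))))
    (λ ¬2∣d → to-dK (d∣E (⊥-elim ∘ ¬2∣d)))
  where
  open FundamentalUnit qd isEps
  E : ℤ
  E = lucasSum (s (suc j)) m
  r∣jo₂ : r ℕDiv.∣ suc j ℕ.* (2 ℕ.* b ℕ.+ 1)
  r∣jo₂ = subst (ℕDiv._∣ _) (≡.sym r≡) (ℕDiv.*-monoˡ-∣ _ (ℕDiv.∣-trans (^-monoʳ-∣ 2 (ℕP.m≤n⊔m ℓ₁ ℓ₂)) 2^ℓ∣j))
  d∣E : (2 ℕDiv.∣ d → + 2 ℤS.∣ t ℤ.+ + 1 × Coprime (suc j) 3 × 3 ℕDiv.∣ 2 ℕ.* m ℕ.+ 1) → d ℕDiv.∣ ℤ.∣ E ∣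
  d∣E = d∣lucasSum ℓ₁ a b (suc j) m ord d≡ r∣jo₂ o₁o₂∣o
  to-dK : d ℕDiv.∣ ℤ.∣ E ∣ → (+ d) ℤDiv.∣ dK D ε (suc j) m
  to-dK = subst (λ z → (+ d) ℤDiv.∣ z) (≡.sym (dK≡lucasSum j m))
  from-dK : (+ d) ℤDiv.∣ dK D ε (suc j) m → d ℕDiv.∣ ℤ.∣ E ∣
  from-dK = subst (λ z → (+ d) ℤDiv.∣ z) (dK≡lucasSum j m)
  2∣d₁⇒2∣t+1 : (+ 2) ℤDiv.∣ d₁K D ε → + 2 ℤS.∣ t ℤ.+ + 1
  2∣d₁⇒2∣t+1 = ℤS.∣ᵤ⇒∣ ∘ subst (λ z → (+ 2) ℤDiv.∣ z) d₁K≡t+1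
  ¬2∣d₁⇒2∣t : ¬ (+ 2) ℤDiv.∣ d₁K D ε → + 2 ℤS.∣ t
  ¬2∣d₁⇒2∣t ¬2∣d₁ = ¬2∣z+1⇒2∣z t (¬2∣d₁ ∘ subst (λ z → (+ 2) ℤDiv.∣ z) (≡.sym d₁K≡t+1) ∘ ℤS.∣⇒∣ᵤ)
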